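{- Let $\mathbf A\in\mathbf{I}_{2,0}$ and $a\in A$. If $0\sqsubseteq a$, then $0\sqsubseteq a'$.
   Context: A zroupoid is an algebra $\langle A,\to,0\rangle$ with binary $\to$ and constant $0$; $x':=x\to 0$. An implication zroupoid satisfies (I) $(x\to y)\to z\approx[(z'\to x)\to(y\to z)']'$ and $0''\approx 0$; $\mathbf{I}_{2,0}$ is the variety of implication zroupoids satisfying $x''\approx x$. For $x,y\in A$, $x\sqsubseteq y$ iff $(x\to y')'=x$. -}

module Defs where

open import Level using (Level; suc)
open import Relation.Binary.PropositionalEquality using (_≡_)

record Zroupoid (a : Level) : Set (suc a) where
  field
    Carrier : Set a
    _⇒_     : Carrier → Carrier → Carrier
    𝟘       : Carrier

  infixr 5 _⇒_

  _′ : Carrier → Carrier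
  x ′ = x ⇒ 𝟘

  infix 8 _′

  _⊑_ : Carrier → Carrier → Set a
  x ⊑ y = ((x ⇒ (y ′)) ′) ≡ x

record IsImplicationZroupoid {a : Level} (Z : Zroupoid a) : Set a where
  open Zroupoid Z
  field
    identityI : ∀ x y z → ((x ⇒ y) ⇒ z) ≡ ((((z ′) ⇒ x) ⇒ ((y ⇒ z) ′)) ′)
    zero″     : ((𝟘 ′) ′) ≡ 𝟘

record IsI20 {a : Level} (Z : Zroupoid a) : Set a where
  open Zroupoid Z
  field
    isImplicationZroupoid : IsImplicationZroupoid Z
    x″≈x                  : ∀ x → ((x ′) ′) ≡ x

module Submission where

-- Work in an arbitrary algebra of I₂,₀, where ′ is an involution,
-- hence injective, so an equation may be proved after priming both sides.
-- From (I) we first derive three general laws: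
--   * 0′ is a left unit:                     0′ → x = x,
--   * a "left absorption" law:               (x → y) → x = (0 → y) → x,
--   * a law moving 0 across an implication:  (x → 0′) → y′ = ((0 → x) → y)′.
-- Now let 0 ⊑ a, i.e. 0 → a′ = 0′.  Then (I) gives the exchange law
-- x → a′ = a → x′, in particular a → 0′ = 0 → a′ = 0′; feeding this into the
-- third law with y = 0 yields 0 → a = 0′.  Finally 0 ⊑ a′ means
-- (0 → a″)′ = 0, and (0 → a″)′ = (0 → a)′ = 0″ = 0.

open import Defs
open import Level using (Level)
open import Relation.Binary.PropositionalEquality
  using (_≡_; sym; trans; cong; cong₂; module ≡-Reasoning)

module I₂,₀-Laws {ℓ : Level} (Z : Zroupoid ℓ) (isI20 : IsI20 Z) where
  open Zroupoid Z
  open IsI20 isI20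
  open IsImplicationZroupoid isImplicationZroupoid
  open ≡-Reasoning

  ′-injective : ∀ {x y} → x ′ ≡ y ′ → x ≡ y
  ′-injective {x} {y} eq = trans (sym (x″≈x x)) (trans (cong _′ eq) (x″≈x y))

  identityI′ : ∀ x y z → ((x ⇒ y) ⇒ z) ′ ≡ ((z ′) ⇒ x) ⇒ ((y ⇒ z) ′)
  identityI′ x y z = trans (cong _′ (identityI x y z)) (x″≈x _)

  0′⇒-absorb : ∀ x y → (𝟘 ′ ⇒ x) ⇒ y ≡ x ⇒ y
  0′⇒-absorb x y = begin
    (𝟘 ′ ⇒ x) ⇒ y              ≡⟨ cong ((𝟘 ′ ⇒ x) ⇒_) (sym (x″≈x y)) ⟩
    (𝟘 ′ ⇒ x) ⇒ (y ′) ′        ≡⟨ sym (identityI′ x y 𝟘) ⟩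
    ((x ⇒ y) ′) ′              ≡⟨ x″≈x (x ⇒ y) ⟩
    x ⇒ y                      ∎

  0′-unitˡ : ∀ x → 𝟘 ′ ⇒ x ≡ x
  0′-unitˡ x = ′-injective (0′⇒-absorb x 𝟘)

  0⇒-law : ∀ y x → ((𝟘 ⇒ y) ⇒ x) ′ ≡ x ⇒ (y ⇒ x) ′
  0⇒-law y x = begin
    ((𝟘 ⇒ y) ⇒ x) ′            ≡⟨ identityI′ 𝟘 y x ⟩
    (x ′) ′ ⇒ (y ⇒ x) ′        ≡⟨ cong (_⇒ (y ⇒ x) ′) (x″≈x x) ⟩
    x ⇒ (y ⇒ x) ′              ∎

  -- 0 → 0′ = 0′ (note that 0 → 0 = 0′ holds by definition of ′).
  0⇒0′ : 𝟘 ⇒ 𝟘 ′ ≡ 𝟘 ′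
  0⇒0′ = ′-injective (begin
    (𝟘 ⇒ 𝟘 ′) ′                ≡⟨ sym (0′-unitˡ _) ⟩
    𝟘 ′ ⇒ (𝟘 ⇒ 𝟘 ′) ′          ≡⟨ sym (0⇒-law 𝟘 (𝟘 ′)) ⟩
    ((𝟘 ⇒ 𝟘) ⇒ 𝟘 ′) ′          ≡⟨ cong _′ (0′-unitˡ (𝟘 ′)) ⟩
    (𝟘 ′) ′                    ∎)

  ⇒-self′ : ∀ x → x ⇒ x ′ ≡ x ′
  ⇒-self′ x = begin
    x ⇒ x ′                    ≡⟨ cong (λ u → x ⇒ u ′) (sym (0′-unitˡ x)) ⟩
    x ⇒ (𝟘 ′ ⇒ x) ′            ≡⟨ sym (0⇒-law (𝟘 ′) x) ⟩
    ((𝟘 ⇒ 𝟘 ′) ⇒ x) ′          ≡⟨ cong (λ u → (u ⇒ x) ′) 0⇒0′ ⟩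
    (𝟘 ′ ⇒ x) ′                ≡⟨ cong _′ (0′-unitˡ x) ⟩
    x ′                        ∎

  ′⇒-self : ∀ x → x ′ ⇒ x ≡ x
  ′⇒-self x = begin
    x ′ ⇒ x                    ≡⟨ cong (x ′ ⇒_) (sym (x″≈x x)) ⟩
    x ′ ⇒ (x ′) ′              ≡⟨ ⇒-self′ (x ′) ⟩
    (x ′) ′                    ≡⟨ x″≈x x ⟩
    x                          ∎

  absorbˡ : ∀ x y → (x ⇒ y) ⇒ x ≡ (𝟘 ⇒ y) ⇒ x
  absorbˡ x y = ′-injective (begin
    ((x ⇒ y) ⇒ x) ′            ≡⟨ identityI′ x y x ⟩
    (x ′ ⇒ x) ⇒ (y ⇒ x) ′      ≡⟨ cong (_⇒ (y ⇒ x) ′) (′⇒-self x) ⟩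
    x ⇒ (y ⇒ x) ′              ≡⟨ sym (0⇒-law y x) ⟩
    ((𝟘 ⇒ y) ⇒ x) ′            ∎)

  ⇒0′-law : ∀ x y → (x ⇒ 𝟘 ′) ⇒ y ′ ≡ ((𝟘 ⇒ x) ⇒ y) ′
  ⇒0′-law x y = begin
    (x ⇒ 𝟘 ′) ⇒ y ′                    ≡⟨ identityI x (𝟘 ′) (y ′) ⟩
    ((y ′ ′ ⇒ x) ⇒ (𝟘 ′ ⇒ y ′) ′) ′    ≡⟨ cong (λ u → ((y ′ ′ ⇒ x) ⇒ u ′) ′) (0′-unitˡ (y ′)) ⟩
    ((y ′ ′ ⇒ x) ⇒ y ′ ′) ′            ≡⟨ cong _′ (absorbˡ (y ′ ′) x) ⟩
    ((𝟘 ⇒ x) ⇒ y ′ ′) ′                ≡⟨ cong (λ u → ((𝟘 ⇒ x) ⇒ u) ′) (x″≈x y) ⟩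
    ((𝟘 ⇒ x) ⇒ y) ′                    ∎

  ⊑-from-0 : ∀ {a} → 𝟘 ⊑ a → 𝟘 ⇒ a ′ ≡ 𝟘 ′
  ⊑-from-0 {a} h = trans (sym (x″≈x _)) (cong _′ h)

  module _ {a : Carrier} (0⊑a : 𝟘 ⊑ a) where

    exchange : ∀ x → x ⇒ a ′ ≡ a ⇒ x ′
    exchange x = begin
      x ⇒ a ′                            ≡⟨ cong (_⇒ a ′) (sym (x″≈x x)) ⟩
      (x ′ ⇒ 𝟘) ⇒ a ′                    ≡⟨ identityI (x ′) 𝟘 (a ′) ⟩
      ((a ′ ′ ⇒ x ′) ⇒ (𝟘 ⇒ a ′) ′) ′    ≡⟨ cong₂ (λ u v → ((u ⇒ x ′) ⇒ v ′) ′) (x″≈x a) (⊑-from-0 0⊑a) ⟩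
      ((a ⇒ x ′) ⇒ 𝟘 ′ ′) ′              ≡⟨ cong (λ u → ((a ⇒ x ′) ⇒ u) ′) (x″≈x 𝟘) ⟩
      (a ⇒ x ′) ′ ′                      ≡⟨ x″≈x (a ⇒ x ′) ⟩
      a ⇒ x ′                            ∎

    0⇒-above-0 : 𝟘 ⇒ a ≡ 𝟘 ′
    0⇒-above-0 = begin
      𝟘 ⇒ a                      ≡⟨ sym (x″≈x (𝟘 ⇒ a)) ⟩
      ((𝟘 ⇒ a) ⇒ 𝟘) ′            ≡⟨ sym (⇒0′-law a 𝟘) ⟩
      (a ⇒ 𝟘 ′) ⇒ 𝟘 ′            ≡⟨ cong (_⇒ 𝟘 ′) (sym (exchange 𝟘)) ⟩
      (𝟘 ⇒ a ′) ⇒ 𝟘 ′            ≡⟨ cong (_⇒ 𝟘 ′) (⊑-from-0 0⊑a) ⟩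
      𝟘 ′ ⇒ 𝟘 ′                  ≡⟨ 0′-unitˡ (𝟘 ′) ⟩
      𝟘 ′                        ∎

    0⊑a′ : 𝟘 ⊑ (a ′)
    0⊑a′ = begin
      (𝟘 ⇒ a ′ ′) ′              ≡⟨ cong (λ u → (𝟘 ⇒ u) ′) (x″≈x a) ⟩
      (𝟘 ⇒ a) ′                  ≡⟨ cong _′ 0⇒-above-0 ⟩
      𝟘 ′ ′                      ≡⟨ zero″ ⟩
      𝟘                          ∎

corollary5p5 : ∀ {ℓ : Level} (A : Zroupoid ℓ) → IsI20 A →
    (a : Zroupoid.Carrier A) →
    Zroupoid._⊑_ A (Zroupoid.𝟘 A) a →
    Zroupoid._⊑_ A (Zroupoid.𝟘 A) (Zroupoid._′ A a)
corollary5p5 A isI20 a 0⊑a = I₂,₀-Laws.0⊑a′ A isI20 0⊑a
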